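{- Let $\sigma(\tau)$ be a tame type for $\mathrm{GL}_2(\mathcal O_{F_v})$ and let $J\in\mathcal P_{\sigma(\tau)}$. If $\tau$ is a principal series type, then $\mathrm{BC}_{\mathrm{PS}}(J)\in\mathcal P_{\mathrm{BC}(\sigma(\tau))}$ and $\mathrm{BC}(\overline\sigma(\tau)_J)=\overline\sigma(\mathrm{BC}(\tau))_{\mathrm{BC}_{\mathrm{PS}}(J)}$. If $\tau$ is a cuspidal type, then $\mathrm{BC}_{\mathrm{cusp}}(J)\in\mathcal P_{\mathrm{BC}(\sigma(\tau))}$ and $\mathrm{BC}(\overline\sigma(\tau)_J)=\overline\sigma(\mathrm{BC}(\tau))_{\mathrm{BC}_{\mathrm{cusp}}(J)}$.
   Context: $k_v=\mathbb F_q$, $q=p^f$, $l_v$ its quadratic extension; $E/\mathbb{Q}_p$ finite with ring of integers $\mathcal O$, residue field $\mathbb F$; fixed embeddings $\overline\kappa_0:k_v\hookrightarrow\mathbb F$, $\overline\kappa'_0:l_v\hookrightarrow\mathbb F$ extending it, $\overline\kappa_{i+1}^p=\overline\kappa_i$, $\overline\kappa'^p_{i+1}=\overline\kappa'_i$; $[\cdot]$ is Teichmüller lifting (for $k_v$ or $l_v$, via these embeddings) and its reduction. For a finite field $k$ of degree $d$ over $\mathbb F_p$ (here $k_v$ with $d=f$ or $l_v$ with $d=2f$, indices mod $d$, $\mathcal S_d=\{0,\dots,d-1\}$), Serre weights are $\bigotimes_{j=0}^{d-1}(\det^{t_j}\mathrm{Sym}^{s_j}k^2)\otimes_{k,\overline\kappa_{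 -j}}\mathbb F$. Principal series types of $\mathrm{GL}_2(k)$: for characters $\eta\ne\eta':k^\times\to\mathcal O^\times$, $\sigma(\eta\otimes\eta')=\mathrm{Ind}_B^{\mathrm{GL}_2(k)}(\eta'\otimes\eta)$ ($\begin{pmatrix}a&b\\0&d\end{pmatrix}\mapsto\eta'(a)\eta(d)$); with $0<c<p^d-1$, $\eta\eta'^{ -1}=[\cdot]^c$, $c=\sum c_jp^j$: $\mathcal P$ is the set of $J\subseteq\mathcal S_d$ with ($j\in J,j-1\notin J\Rightarrow c_j\ne p-1$) and ($j\notin J,j-1\in J\Rightarrow c_j\ne0$), and for $J\in\mathcal P$ the factor labelled $J$ is $\overline\sigma_{\vec t,\vec s}\otimes\overline\eta'\circ\det$ with $s_{J,i}=p-1-c_i-\delta_{J^c}(i-1)$ ($i\in J$), $c_i-\delta_J(i-1)$ ($i\notin J$), $t_{J,i}=c_i+\delta_{J^c}(i-1)$ ($i\in J$), $0$ otherwise. Cuspidal types of $\mathrm{GL}_2(k_v)$: $\Theta(\psi)$ for $\psi:l_v^\times\to\mathcal O^\times$ not factoring through the norm; write $\psi=[x]^{(q+1)b+1+c}$, $0\le b\le q-2$, $0\le c\le q-1$, $c=\sum_{i<f}c_ip^i$, $J_0=J\triangle\{f-1\}$; $\mathcal P$ is the set of $J\subseteq\mathcal S_f$ with ($j\in J,j-1\notin J_0\Rightarrow c_j\ne p-1$) and ($j\notin J,j-1\in J_0\Rightarrow c_j\ne0$); factor labelled $J$: $\overline\sigma_{\vec t,\vec s}\otimes[\cdot]^{(q+1)b+\delta_J(0)\delta_J(f-1)+\delta_{J^c}(0)\delta_{J^c}(f-1)}\circ\det$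 with $s_{J,i}=p-1-c_i-\delta_{J_0^c}(i-1)$ ($i\in J$), $c_i-\delta_{J_0}(i-1)$ ($i\notin J$), $t_{J,i}$ as before. Types and labels for $\mathrm{GL}_2(\mathcal O_{F_v})$ are inflated from $\mathrm{GL}_2(k_v)$; $\overline\sigma(\tau)_J$ denotes the factor labelled $J$. Base change: $\mathrm{BC}(\sigma(\eta\otimes\eta'))=\sigma(\eta\circ N_{l_v/k_v}\otimes\eta'\circ N_{l_v/k_v})$; $\mathrm{BC}(\Theta(\psi))=\sigma(\psi\otimes\psi^q)$ (depending on the choice of $\psi$); in terms of inertial types $\mathrm{BC}(\tau)$ is $\tau$ viewed as an inertial type of $L_v$. For a Serre weight $\overline\sigma_{\vec t,\vec s}$ of $\mathrm{GL}_2(k_v)$, $\mathrm{BC}(\overline\sigma_{\vec t,\vec s})$ is the weight of $\mathrm{GL}_2(l_v)$ with $t'_j=t_{j\bmod f}$, $s'_j=s_{j\bmod f}$ for $0\le j\le2f-1$. For $J\subseteq\mathcal S_f$: $\mathrm{BC}_{\mathrm{PS}}(J)=\{i\in\mathcal S_{2f}:i\bmod f\in J\}$ and $\mathrm{BC}_{\mathrm{cusp}}(J)=\{i\le f-1:i\in J\}\cup\{f\le i\le2f-1:i-f\notin J\}$. -}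

module Defs where

open import Data.Nat using (ℕ; zero; suc; _+_; _*_; _∸_; _^_; _≡ᵇ_)
open import Data.Nat.DivMod using (_%_; _/_)
open import Data.Bool using (Bool; true; false; if_then_else_; not; _∧_)
open import Data.Fin using (Fin; zero; suc; toℕ; fromℕ; inject₁; splitAt)
open import Data.Fin.Subset using (Subset)
open import Data.Vec using ([]; _∷_; lookup; tabulate; sum)
open import Data.Sum using ([_,_]′)
open import Data.Product using (_×_)
open import Function using (id)
open import Relation.Binary.PropositionalEquality using (_≡_; _≢_)

-- Conventions.  p is the residue characteristic, a finite field k of
-- degree d over F_p has k^× cyclic of order N = p^d - 1.  A character
-- k^× → O^× (or → F^×) is [·]^a for an exponent a : ℕ, determined by
-- a mod N.  Subsets J ⊆ S_d = {0,…,d-1} are 'Subset d' (Vec Bool d).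

-- reduction mod N = p ^ d ∸ 1 (written suc (p ^ d ∸ 2), which equals
-- p ^ d ∸ 1 whenever p ^ d ≥ 2, e.g. p prime and d ≥ 1)
red : ℕ → ℕ → ℕ → ℕ
red p d x = x % suc (p ^ d ∸ 2)

-- j-th base-p digit of c  (suc (p ∸ 1) = p for p ≥ 1)
digit : ℕ → ℕ → ℕ → ℕ
digit p c zero    = c % suc (p ∸ 1)
digit p c (suc j) = digit p (c / suc (p ∸ 1)) j

prev : ∀ {d} → Fin d → Fin d
prev {suc n} zero    = fromℕ n
prev {suc n} (suc i) = inject₁ i

δ : Bool → ℕ
δ true  = 1
δ false = 0

memℕ : ∀ {d} → Subset d → ℕ → Bool
memℕ []      k       = false
memℕ (x ∷ J) zero    = x
memℕ (x ∷ J) (suc k) = memℕ J k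

-- Serre weights of GL_2(k), [k : F_p] = d:
-- (⊗_j det^{t_j} Sym^{s_j} k^2 ⊗_{κ_{-j}} F) ⊗ [·]^{tw} ∘ det.
record Weight (d : ℕ) : Set where
  constructor weight
  field
    t  : Fin d → ℕ
    s  : Fin d → ℕ
    tw : ℕ
open Weight public

-- exponent of the central/determinant character: since κ_{-j} = κ_0^{p^j},
-- det^{t_j} through κ_{-j} is [det]^{t_j p^j}
detExp : ℕ → ∀ {d} → Weight d → ℕ
detExp p {d} w = sum (tabulate (λ j → t w j * p ^ toℕ j)) + tw w

-- isomorphism of Serre weights: same Sym-exponents and same determinant
-- character of k^× (exponents congruent mod p^d - 1)
WtIso : ℕ → (d : ℕ) → Weight d → Weight d → Set
WtIso p d w w' = (∀ j → s w j ≡ s w' j) × (red p d (detExp p w) ≡ red p d (detExp p w'))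

-- Labels.  'Jp' is the set used for the predecessor conditions
-- (Jp = J for principal series, Jp = J₀ for cuspidal types).

Adm : ℕ → (d : ℕ) → ℕ → Subset d → Subset d → Set
Adm p d c J Jp = ∀ j →
  (lookup J j ≡ true → lookup Jp (prev j) ≡ false → digit p c (toℕ j) ≢ p ∸ 1) ×
  (lookup J j ≡ false → lookup Jp (prev j) ≡ true → digit p c (toℕ j) ≢ 0)

sLab : ℕ → (d : ℕ) → ℕ → Subset d → Subset d → Fin d → ℕ
sLab p d c J Jp i =
  if lookup J i
  then p ∸ 1 ∸ digit p c (toℕ i) ∸ δ (not (lookup Jp (prev i)))
  else digit p c (toℕ i) ∸ δ (lookup Jp (prev i))

tLab : ℕ → (d : ℕ) → ℕ → Subset d → Fin d → ℕ
tLab p d c J i =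
  if lookup J i then digit p c (toℕ i) + δ (not (lookup J (prev i))) else 0

-- Principal series type σ(η ⊗ η') of GL_2(k), η = [·]^a, η' = [·]^{a'},
-- (η ≠ η' means red p d a ≢ red p d a').
-- c ∈ (0, p^d - 1) with η η'^{-1} = [·]^c:  c = (a - a') mod N.
psC : ℕ → ℕ → ℕ → ℕ → ℕ
psC p d a a' = red p d (a + (p ^ d ∸ 2) * a')

psP : ℕ → (d : ℕ) → ℕ → ℕ → Subset d → Set
psP p d a a' J = Adm p d (psC p d a a') J J

psFactor : ℕ → (d : ℕ) → ℕ → ℕ → Subset d → Weight d
psFactor p d a a' J =
  weight (tLab p d (psC p d a a') J) (sLab p d (psC p d a a') J J) a'

-- Cuspidal type Θ(ψ) of GL_2(k_v), [k_v : F_p] = f,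
-- ψ = [·]^{(q+1) b + 1 + c}, 0 ≤ b ≤ q - 2, 0 ≤ c ≤ q - 1.

J₀ : ∀ {f} → Subset f → Subset f
J₀ {f} J = tabulate (λ i → if toℕ i ≡ᵇ (f ∸ 1) then not (lookup J i) else lookup J i)

cuspP : ℕ → (f : ℕ) → ℕ → Subset f → Set
cuspP p f c J = Adm p f c J (J₀ J)

cuspFactor : ℕ → (f : ℕ) → ℕ → ℕ → Subset f → Weight f
cuspFactor p f b c J =
  weight (tLab p f c J) (sLab p f c J (J₀ J))
         (b + δ (memℕ J 0 ∧ memℕ J (f ∸ 1))
            + δ (not (memℕ J 0) ∧ not (memℕ J (f ∸ 1))))

cuspψ : ℕ → ℕ → ℕ → ℕ → ℕ
cuspψ p f b c = (p ^ f + 1) * b + 1 + c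

-- Base change to l_v, [l_v : F_p] = 2f, indices of S_{2f} as Fin (f + f).

modF : ∀ f → Fin (f + f) → Fin f
modF f i = [ id , id ]′ (splitAt f i)

-- BC of a Serre weight: t'_j = t_{j mod f}, s'_j = s_{j mod f}; a twist
-- χ ∘ det becomes (χ ∘ N_{l_v/k_v}) ∘ det, N(x) = x^{q+1}.
bcW : ℕ → (f : ℕ) → Weight f → Weight (f + f)
bcW p f w = weight (λ j → t w (modF f j)) (λ j → s w (modF f j)) ((p ^ f + 1) * tw w)

bcPS : ∀ f → Subset f → Subset (f + f)
bcPS f J = tabulate (λ i → lookup J (modF f i))

bcCusp : ∀ f → Subset f → Subset (f + f)
bcCusp f J = tabulate (λ i → [ lookup J , (λ k → not (lookup J k)) ]′ (splitAt f i))

{-# OPTIONS --safe #-}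

-- Write q = p^f and c_i for the base-p digits of c.  For a principal series type the
-- exponent of η η'⁻¹ after base change is (q + 1) c = c + q c mod q² − 1, whose 2f digits
-- are those of c written twice; since the labelled factor at index j depends only on
-- (j ∈ J, j − 1 ∈ J, c_j), everything is read off at j mod f.  For a cuspidal type the
-- exponent becomes c + q e with e = q − 1 − c, so the upper digits are p − 1 − c_i, while
-- BC_cusp(J) is the complement of J on the upper half; complementing the membership data
-- and the digit together preserves admissibility and the Sym-exponents.  The
-- det-exponents change, but summing the digitwise relation between them, the carry from
-- position i into i + 1 matches the shift from J to J₀, and the two determinant
-- characters differ by a multiple of q² − 1.

module Submission where

open import Defs
open import Data.Bool using (Bool; true; false; if_then_else_; not; _∧_)
open import Data.Bool.Properties using (not-involutive)
open import Data.Fin using (Fin; zero; suc; toℕ; fromℕ; inject₁; splitAt; _↑ˡ_; _↑ʳ_)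
open import Data.Fin.Properties
  using (toℕ-injective; toℕ-↑ˡ; toℕ-↑ʳ; toℕ-fromℕ; toℕ-inject₁; toℕ<n; splitAt-↑ˡ; splitAt-↑ʳ; splitAt⁻¹-↑ˡ; splitAt⁻¹-↑ʳ)
open import Data.Fin.Subset using (Subset)
open import Data.Nat using (ℕ; zero; suc; _+_; _*_; _∸_; _^_; _≤_; _<_; s≤s; z≤n; _≡ᵇ_)
open import Data.Nat.DivMod
open import Data.Nat.Divisibility using (divides)
open import Data.Nat.Base using (nonTrivial⇒n>1)
open import Data.Nat.Primality using (Prime; prime⇒nonTrivial)
open import Data.Nat.Properties
open import Data.Nat.Tactic.RingSolver using (solve-∀)
open import Data.Product using (_×_; _,_; proj₁; proj₂)
open import Data.Sum using (inj₁; inj₂; [_,_]′)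
open import Data.Vec using (lookup; tabulate)
import Data.Vec as Vec
open import Data.Vec.Properties using (lookup∘tabulate; tabulate-cong)
open import Function using (_∘_; id)
open import Relation.Binary.PropositionalEquality

open import Algebra.Properties.Semiring.Sum +-*-semiring
  using (sum-syntax; ∑-distrib-+; *-distribˡ-sum; sum-init-last; sum-cong-≗)
import Algebra.Properties.CommutativeSemigroup as CommutativeSemigroupProperties
open CommutativeSemigroupProperties *-commutativeSemigroup using (x∙yz≈y∙xz)
open CommutativeSemigroupProperties +-commutativeSemigroup using () renaming (xy∙z≈xz∙y to m+n+o≡m+o+n)

-- Base-p expansions

radix : ℕ → ∀ {d} → (Fin d → ℕ) → ℕ
radix p {d} g = ∑[ i < d ] (g i * p ^ toℕ i)

vsum-tabulate : ∀ {n} (g : Fin n → ℕ) → Vec.sum (tabulate g) ≡ ∑[ i < n ] g i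
vsum-tabulate {zero}  g = refl
vsum-tabulate {suc n} g = cong (g zero +_) (vsum-tabulate (g ∘ suc))

detExp-radix : ∀ p {d} (w : Weight d) → detExp p w ≡ radix p (t w) + tw w
detExp-radix p w = cong (_+ tw w) (vsum-tabulate (λ j → t w j * p ^ toℕ j))

module _ (p : ℕ) where

  radix-cong : ∀ {d} {u v : Fin d → ℕ} → (∀ i → u i ≡ v i) → radix p u ≡ radix p v
  radix-cong u≗v = sum-cong-≗ (λ i → cong (_* p ^ toℕ i) (u≗v i))

  radix-+ : ∀ {d} (u v : Fin d → ℕ) → radix p (λ i → u i + v i) ≡ radix p u + radix p v
  radix-+ u v = trans (sum-cong-≗ (λ i → *-distribʳ-+ (p ^ toℕ i) (u i) (v i)))
                      (∑-distrib-+ (λ i → u i * p ^ toℕ i) (λ i → v i * p ^ toℕ i))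

  radix-*ˡ : ∀ {d} k (u : Fin d → ℕ) → radix p (λ i → k * u i) ≡ k * radix p u
  radix-*ˡ k u = trans (sum-cong-≗ (λ i → *-assoc k (u i) (p ^ toℕ i)))
                       (sym (*-distribˡ-sum k (λ i → u i * p ^ toℕ i)))

  radix-suc : ∀ {n} (g : Fin (suc n) → ℕ) → radix p g ≡ g zero + p * radix p (g ∘ suc)
  radix-suc g = cong₂ _+_ (*-identityʳ (g zero))
    (trans (sum-cong-≗ (λ i → x∙yz≈y∙xz (g (suc i)) p (p ^ toℕ i)))
           (sym (*-distribˡ-sum p (λ i → g (suc i) * p ^ toℕ i))))

  radix-↑ : ∀ f (g : Fin (f + f) → ℕ) →
            radix p g ≡ radix p (λ i → g (i ↑ˡ f)) + p ^ f * radix p (λ i → g (f ↑ʳ i))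
  radix-↑ f g = begin
    radix p g
      ≡⟨ ∑-↑ f (λ j → g j * p ^ toℕ j) ⟩
    ∑[ i < f ] (g (i ↑ˡ f) * p ^ toℕ (i ↑ˡ f)) + ∑[ i < f ] (g (f ↑ʳ i) * p ^ toℕ (f ↑ʳ i))
      ≡⟨ cong₂ _+_ (sum-cong-≗ low) (sum-cong-≗ high) ⟩
    radix p (λ i → g (i ↑ˡ f)) + ∑[ i < f ] (p ^ f * (g (f ↑ʳ i) * p ^ toℕ i))
      ≡⟨ cong (radix p (λ i → g (i ↑ˡ f)) +_) (sym (*-distribˡ-sum (p ^ f) (λ i → g (f ↑ʳ i) * p ^ toℕ i))) ⟩
    radix p (λ i → g (i ↑ˡ f)) + p ^ f * radix p (λ i → g (f ↑ʳ i)) ∎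
    where
    open ≡-Reasoning
    ∑-↑ : ∀ m {n} (h : Fin (m + n) → ℕ) → ∑[ j < m + n ] h j ≡ ∑[ i < m ] h (i ↑ˡ n) + ∑[ i < n ] h (m ↑ʳ i)
    ∑-↑ zero    h = refl
    ∑-↑ (suc m) {n} h = trans (cong (h zero +_) (∑-↑ m (h ∘ suc)))
                             (sym (+-assoc (h zero) (∑[ i < m ] h (suc i ↑ˡ n)) (∑[ i < n ] h (suc m ↑ʳ i))))
    low : ∀ i → g (i ↑ˡ f) * p ^ toℕ (i ↑ˡ f) ≡ g (i ↑ˡ f) * p ^ toℕ i
    low i = cong (λ k → g (i ↑ˡ f) * p ^ k) (toℕ-↑ˡ i f)
    high : ∀ i → g (f ↑ʳ i) * p ^ toℕ (f ↑ʳ i) ≡ p ^ f * (g (f ↑ʳ i) * p ^ toℕ i)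
    high i = begin
      g (f ↑ʳ i) * p ^ toℕ (f ↑ʳ i)    ≡⟨ cong (λ k → g (f ↑ʳ i) * p ^ k) (toℕ-↑ʳ f i) ⟩
      g (f ↑ʳ i) * p ^ (f + toℕ i)     ≡⟨ cong (g (f ↑ʳ i) *_) (^-distribˡ-+-* p f (toℕ i)) ⟩
      g (f ↑ʳ i) * (p ^ f * p ^ toℕ i) ≡⟨ x∙yz≈y∙xz (g (f ↑ʳ i)) (p ^ f) (p ^ toℕ i) ⟩
      p ^ f * (g (f ↑ʳ i) * p ^ toℕ i) ∎

  radix-rotate : ∀ {n} (x z : Fin (suc n) → ℕ) → (∀ k → z (suc k) ≡ x (inject₁ k)) →
                 p * radix p x + z zero ≡ radix p z + x (fromℕ n) * p ^ suc n
  radix-rotate {n} x z z∘suc≗x∘inject₁ = begin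
    p * radix p x + z zero
      ≡⟨ cong (_+ z zero) (*-distribˡ-sum p (λ i → x i * p ^ toℕ i)) ⟩
    ∑[ i < suc n ] (p * (x i * p ^ toℕ i)) + z zero
      ≡⟨ cong (_+ z zero) (sum-cong-≗ (λ i → x∙yz≈y∙xz p (x i) (p ^ toℕ i))) ⟩
    ∑[ i < suc n ] (x i * p ^ suc (toℕ i)) + z zero
      ≡⟨ cong (_+ z zero) (sum-init-last (λ i → x i * p ^ suc (toℕ i))) ⟩
    ∑[ k < n ] (x (inject₁ k) * p ^ suc (toℕ (inject₁ k))) + x (fromℕ n) * p ^ suc (toℕ (fromℕ n)) + z zero
      ≡⟨ cong (λ y → y + z zero) (cong₂ _+_ (sum-cong-≗ shifted) (cong (λ k → x (fromℕ n) * p ^ suc k) (toℕ-fromℕ n))) ⟩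
    ∑[ k < n ] (z (suc k) * p ^ suc (toℕ k)) + x (fromℕ n) * p ^ suc n + z zero
      ≡⟨ rotate (∑[ k < n ] (z (suc k) * p ^ suc (toℕ k))) (x (fromℕ n) * p ^ suc n) (z zero) ⟩
    radix p z + x (fromℕ n) * p ^ suc n ∎
    where
    open ≡-Reasoning
    shifted : ∀ k → x (inject₁ k) * p ^ suc (toℕ (inject₁ k)) ≡ z (suc k) * p ^ suc (toℕ k)
    shifted k = cong₂ (λ a t → a * p ^ suc t) (sym (z∘suc≗x∘inject₁ k)) (toℕ-inject₁ k)
    rotate : ∀ a b c → a + b + c ≡ c * 1 + a + b
    rotate = solve-∀

-- Base-p digits

module BaseDigits (s : ℕ) where

  private
    p : ℕ
    p = suc s

    p^suc-shift : ∀ f X → p ^ suc f * X ≡ p ^ f * X * p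
    p^suc-shift f X = trans (*-assoc p (p ^ f) X) (*-comm p (p ^ f * X))

    mod-step : ∀ f c X → (c + p ^ suc f * X) % p ≡ c % p
    mod-step f c X = trans (cong (λ y → (c + y) % p) (p^suc-shift f X)) ([m+kn]%n≡m%n c (p ^ f * X) p)

    div-step : ∀ f c X → (c + p ^ suc f * X) / p ≡ c / p + p ^ f * X
    div-step f c X = begin
      (c + p ^ suc f * X) / p      ≡⟨ cong (λ y → (c + y) / p) (p^suc-shift f X) ⟩
      (c + p ^ f * X * p) / p      ≡⟨ +-distrib-/-∣ʳ c (divides (p ^ f * X) refl) ⟩
      c / p + p ^ f * X * p / p    ≡⟨ cong (c / p +_) (m*n/n≡m (p ^ f * X) p) ⟩
      c / p + p ^ f * X            ∎
      where open ≡-Reasoning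

    quotient-< : ∀ f {c} → c < p ^ suc f → c / p < p ^ f
    quotient-< f {c} c< = m<n*o⇒m/o<n (subst (c <_) (*-comm p (p ^ f)) c<)

  radix-all-max : ∀ f → radix p {f} (λ _ → s) + 1 ≡ p ^ f
  radix-all-max zero    = refl
  radix-all-max (suc f) = begin
    radix p {suc f} (λ _ → s) + 1        ≡⟨ cong (_+ 1) (radix-suc p {f} (λ _ → s)) ⟩
    s + p * radix p {f} (λ _ → s) + 1    ≡⟨ factor s (radix p {f} (λ _ → s)) ⟩
    p * (radix p {f} (λ _ → s) + 1)      ≡⟨ cong (p *_) (radix-all-max f) ⟩
    p * p ^ f                            ∎
    where
    open ≡-Reasoning
    factor : ∀ s R → s + suc s * R + 1 ≡ suc s * (R + 1)
    factor = solve-∀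

  radix-digits : ∀ f {c} → c < p ^ f → radix p (λ (i : Fin f) → digit p c (toℕ i)) ≡ c
  radix-digits zero    {zero}  _        = refl
  radix-digits zero    {suc _} (s≤s ())
  radix-digits (suc f) {c}     c<       = begin
    radix p (λ (i : Fin (suc f)) → digit p c (toℕ i))  ≡⟨ radix-suc p {f} (λ i → digit p c (toℕ i)) ⟩
    c % p + p * radix p (λ (i : Fin f) → digit p (c / p) (toℕ i)) ≡⟨ cong (λ y → c % p + p * y) (radix-digits f (quotient-< f c<)) ⟩
    c % p + p * (c / p)                                ≡⟨ cong (c % p +_) (*-comm p (c / p)) ⟩
    c % p + c / p * p                                  ≡⟨ m≡m%n+[m/n]*n c p ⟨
    c                                                  ∎
    where open ≡-Reasoning

  digit-+-^-low : ∀ f c X {k} → k < f → digit p (c + p ^ f * X) k ≡ digit p c k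
  digit-+-^-low (suc f) c X {zero}  _         = mod-step f c X
  digit-+-^-low (suc f) c X {suc k} (s≤s k<f) =
    trans (cong (λ y → digit p y k) (div-step f c X)) (digit-+-^-low f (c / p) X k<f)

  digit-+-^-high : ∀ f {c} X k → c < p ^ f → digit p (c + p ^ f * X) (f + k) ≡ digit p X k
  digit-+-^-high zero    {zero}  X k _        = cong (λ y → digit p y k) (+-identityʳ X)
  digit-+-^-high zero    {suc _} X k (s≤s ())
  digit-+-^-high (suc f) {c}     X k c<       =
    trans (cong (λ y → digit p y (f + k)) (div-step f c X)) (digit-+-^-high f X k (quotient-< f c<))

  -- Two digits plus a carry lie in [1, 2p − 1], so a multiple of p among them is p itself.
  carry : ∀ {u v X Y} → u < p → v < p → suc (u + v) + X * p ≡ Y * p → u + v ≡ s × suc X ≡ Y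
  carry {u} {v} {X} {Y} u<p v<p eq =
    suc-injective (+-cancelʳ-≡ (X * p) (suc (u + v)) p (trans eq (cong (_* p) (sym 1+X≡Y)))) , 1+X≡Y
    where
    open ≤-Reasoning
    X<Y : X < Y
    X<Y = *-cancelʳ-< p X Y (begin-strict
      X * p                 <⟨ m<n+m (X * p) (s≤s z≤n) ⟩
      suc (u + v) + X * p   ≡⟨ eq ⟩
      Y * p                 ∎)
    Y<2+X : Y < suc (suc X)
    Y<2+X = *-cancelʳ-< p Y (suc (suc X)) (begin-strict
      Y * p                 ≡⟨ eq ⟨
      suc (u + v) + X * p   <⟨ +-monoˡ-< (X * p) (s≤s (+-mono-≤-< (≤-pred u<p) v<p)) ⟩
      p + p + X * p         ≡⟨ +-assoc p p (X * p) ⟩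
      suc (suc X) * p       ∎)
    1+X≡Y : suc X ≡ Y
    1+X≡Y = ≤-antisym X<Y (≤-pred Y<2+X)

  digit-complement : ∀ f {c e k} → suc (c + e) ≡ p ^ f → k < f → digit p c k + digit p e k ≡ s
  digit-complement (suc f) {c} {e} {k} 1+c+e≡ k<f
    with carry {X = c / p + e / p} {Y = p ^ f} (m%n<n c p) (m%n<n e p) lowest
    where
    lowest : suc (c % p + e % p) + (c / p + e / p) * p ≡ p ^ f * p
    lowest = begin
      suc (c % p + e % p) + (c / p + e / p) * p        ≡⟨ regroup (c % p) (e % p) (c / p) (e / p) p ⟩
      suc ((c % p + c / p * p) + (e % p + e / p * p))  ≡⟨ cong₂ (λ x y → suc (x + y)) (m≡m%n+[m/n]*n c p) (m≡m%n+[m/n]*n e p) ⟨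
      suc (c + e)                                      ≡⟨ 1+c+e≡ ⟩
      p * p ^ f                                        ≡⟨ *-comm p (p ^ f) ⟩
      p ^ f * p                                        ∎
      where
      open ≡-Reasoning
      regroup : ∀ a b x y p → suc (a + b) + (x + y) * p ≡ suc ((a + x * p) + (b + y * p))
      regroup = solve-∀
  ... | digits , quotients with k
  ...   | zero  = digits
  ...   | suc k = digit-complement f quotients (≤-pred k<f)

-- Indices of S_{2f}

↑-elim : ∀ {m n} (P : Fin (m + n) → Set) → (∀ i → P (i ↑ˡ n)) → (∀ i → P (m ↑ʳ i)) → ∀ j → P j
↑-elim {m} P low high j with splitAt m j in eq
... | inj₁ i = subst P (splitAt⁻¹-↑ˡ eq) (low i)
... | inj₂ i = subst P (splitAt⁻¹-↑ʳ eq) (high i)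

lookup≡memℕ : ∀ {d} (J : Subset d) i → lookup J i ≡ memℕ J (toℕ i)
lookup≡memℕ (x Vec.∷ J) zero    = refl
lookup≡memℕ (x Vec.∷ J) (suc i) = lookup≡memℕ J i

modF-↑ˡ : ∀ f (i : Fin f) → modF f (i ↑ˡ f) ≡ i
modF-↑ˡ f i = cong [ id , id ]′ (splitAt-↑ˡ f i f)

modF-↑ʳ : ∀ f (i : Fin f) → modF f (f ↑ʳ i) ≡ i
modF-↑ʳ f i = cong [ id , id ]′ (splitAt-↑ʳ f f i)

module _ (n : ℕ) where

  private
    f : ℕ
    f = suc n

  open ≡-Reasoning

  prev-↑ˡ-zero : prev (zero {n} ↑ˡ f) ≡ f ↑ʳ fromℕ n
  prev-↑ˡ-zero = toℕ-injective (begin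
    toℕ (fromℕ (n + f))     ≡⟨ toℕ-fromℕ (n + f) ⟩
    n + f                   ≡⟨ +-suc n n ⟩
    f + n                   ≡⟨ cong (f +_) (toℕ-fromℕ n) ⟨
    f + toℕ (fromℕ n)       ≡⟨ toℕ-↑ʳ f (fromℕ n) ⟨
    toℕ (f ↑ʳ fromℕ n)      ∎)

  prev-↑ˡ-suc : ∀ (i : Fin n) → prev (suc i ↑ˡ f) ≡ inject₁ i ↑ˡ f
  prev-↑ˡ-suc i = toℕ-injective (begin
    toℕ (inject₁ (i ↑ˡ f))  ≡⟨ toℕ-inject₁ (i ↑ˡ f) ⟩
    toℕ (i ↑ˡ f)            ≡⟨ toℕ-↑ˡ i f ⟩
    toℕ i                   ≡⟨ toℕ-inject₁ i ⟨
    toℕ (inject₁ i)         ≡⟨ toℕ-↑ˡ (inject₁ i) f ⟨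
    toℕ (inject₁ i ↑ˡ f)    ∎)

  prev-↑ʳ-zero : prev (f ↑ʳ zero {n}) ≡ fromℕ n ↑ˡ f
  prev-↑ʳ-zero = toℕ-injective (begin
    toℕ (inject₁ (n ↑ʳ zero {n})) ≡⟨ toℕ-inject₁ (n ↑ʳ zero {n}) ⟩
    toℕ (n ↑ʳ zero {n})           ≡⟨ toℕ-↑ʳ n (zero {n}) ⟩
    n + 0                         ≡⟨ +-identityʳ n ⟩
    n                             ≡⟨ toℕ-fromℕ n ⟨
    toℕ (fromℕ n)                 ≡⟨ toℕ-↑ˡ (fromℕ n) f ⟨
    toℕ (fromℕ n ↑ˡ f)            ∎)

  prev-↑ʳ-suc : ∀ (i : Fin n) → prev (f ↑ʳ suc i) ≡ f ↑ʳ inject₁ i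
  prev-↑ʳ-suc i = toℕ-injective (begin
    toℕ (inject₁ (n ↑ʳ suc i))    ≡⟨ toℕ-inject₁ (n ↑ʳ suc i) ⟩
    toℕ (n ↑ʳ suc i)              ≡⟨ toℕ-↑ʳ n (suc i) ⟩
    n + suc (toℕ i)               ≡⟨ +-suc n (toℕ i) ⟩
    f + toℕ i                     ≡⟨ cong (f +_) (toℕ-inject₁ i) ⟨
    f + toℕ (inject₁ i)           ≡⟨ toℕ-↑ʳ f (inject₁ i) ⟨
    toℕ (f ↑ʳ inject₁ i)          ∎)

  modF-prev : ∀ j → modF f (prev j) ≡ prev (modF f j)
  modF-prev = ↑-elim {f} {f} (λ j → modF f (prev j) ≡ prev (modF f j)) low high
    where
    low : ∀ i → modF f (prev (i ↑ˡ f)) ≡ prev (modF f (i ↑ˡ f))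
    low zero    = trans (cong (modF f) prev-↑ˡ-zero) (modF-↑ʳ f (fromℕ n))
    low (suc i) = trans (cong (modF f) (prev-↑ˡ-suc i))
                        (trans (modF-↑ˡ f (inject₁ i)) (cong prev (sym (modF-↑ˡ f (suc i)))))
    high : ∀ i → modF f (prev (f ↑ʳ i)) ≡ prev (modF f (f ↑ʳ i))
    high zero    = trans (cong (modF f) prev-↑ʳ-zero)
                         (trans (modF-↑ˡ f (fromℕ n)) (cong prev (sym (modF-↑ʳ f (zero {n})))))
    high (suc i) = trans (cong (modF f) (prev-↑ʳ-suc i))
                         (trans (modF-↑ʳ f (inject₁ i)) (cong prev (sym (modF-↑ʳ f (suc i)))))

  module _ (J : Subset f) where

    private
      cuspMember : Fin (f + f) → Bool
      cuspMember j = [ lookup J , (λ k → not (lookup J k)) ]′ (splitAt f j)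
      flipLast : Fin f → Bool
      flipLast i = if toℕ i ≡ᵇ n then not (lookup J i) else lookup J i

    lookup-bcPS : ∀ j → lookup (bcPS f J) j ≡ lookup J (modF f j)
    lookup-bcPS = lookup∘tabulate (λ j → lookup J (modF f j))

    lookup-bcPS-prev : ∀ j → lookup (bcPS f J) (prev j) ≡ lookup J (prev (modF f j))
    lookup-bcPS-prev j = trans (lookup-bcPS (prev j)) (cong (lookup J) (modF-prev j))

    lookup-bcCusp-↑ˡ : ∀ i → lookup (bcCusp f J) (i ↑ˡ f) ≡ lookup J i
    lookup-bcCusp-↑ˡ i = trans (lookup∘tabulate cuspMember (i ↑ˡ f))
                               (cong [ lookup J , (λ k → not (lookup J k)) ]′ (splitAt-↑ˡ f i f))

    lookup-bcCusp-↑ʳ : ∀ i → lookup (bcCusp f J) (f ↑ʳ i) ≡ not (lookup J i)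
    lookup-bcCusp-↑ʳ i = trans (lookup∘tabulate cuspMember (f ↑ʳ i))
                               (cong [ lookup J , (λ k → not (lookup J k)) ]′ (splitAt-↑ʳ f f i))

    lookup-J₀-fromℕ : lookup (J₀ J) (fromℕ n) ≡ not (lookup J (fromℕ n))
    lookup-J₀-fromℕ = trans (lookup∘tabulate flipLast (fromℕ n))
      (cong (λ b → if b then not (lookup J (fromℕ n)) else lookup J (fromℕ n)) (fromℕ-≡ᵇ n))
      where
      fromℕ-≡ᵇ : ∀ n → (toℕ (fromℕ n) ≡ᵇ n) ≡ true
      fromℕ-≡ᵇ zero    = refl
      fromℕ-≡ᵇ (suc n) = fromℕ-≡ᵇ n

    lookup-J₀-inject₁ : ∀ i → lookup (J₀ J) (inject₁ i) ≡ lookup J (inject₁ i)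
    lookup-J₀-inject₁ i = trans (lookup∘tabulate flipLast (inject₁ i))
      (cong (λ b → if b then not (lookup J (inject₁ i)) else lookup J (inject₁ i)) (inject₁-≡ᵇ i))
      where
      inject₁-≡ᵇ : ∀ {n} (i : Fin n) → (toℕ (inject₁ i) ≡ᵇ n) ≡ false
      inject₁-≡ᵇ zero    = refl
      inject₁-≡ᵇ (suc i) = inject₁-≡ᵇ i

    lookup-bcCusp-prev-↑ˡ : ∀ i → lookup (bcCusp f J) (prev (i ↑ˡ f)) ≡ lookup (J₀ J) (prev i)
    lookup-bcCusp-prev-↑ˡ zero    = begin
      lookup (bcCusp f J) (prev (zero ↑ˡ f))  ≡⟨ cong (lookup (bcCusp f J)) prev-↑ˡ-zero ⟩
      lookup (bcCusp f J) (f ↑ʳ fromℕ n)      ≡⟨ lookup-bcCusp-↑ʳ (fromℕ n) ⟩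
      not (lookup J (fromℕ n))                ≡⟨ lookup-J₀-fromℕ ⟨
      lookup (J₀ J) (fromℕ n)                 ∎
    lookup-bcCusp-prev-↑ˡ (suc i) = begin
      lookup (bcCusp f J) (prev (suc i ↑ˡ f)) ≡⟨ cong (lookup (bcCusp f J)) (prev-↑ˡ-suc i) ⟩
      lookup (bcCusp f J) (inject₁ i ↑ˡ f)    ≡⟨ lookup-bcCusp-↑ˡ (inject₁ i) ⟩
      lookup J (inject₁ i)                    ≡⟨ lookup-J₀-inject₁ i ⟨
      lookup (J₀ J) (inject₁ i)               ∎

    lookup-bcCusp-prev-↑ʳ : ∀ i → lookup (bcCusp f J) (prev (f ↑ʳ i)) ≡ not (lookup (J₀ J) (prev i))
    lookup-bcCusp-prev-↑ʳ zero    = begin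
      lookup (bcCusp f J) (prev (f ↑ʳ zero))  ≡⟨ cong (lookup (bcCusp f J)) prev-↑ʳ-zero ⟩
      lookup (bcCusp f J) (fromℕ n ↑ˡ f)      ≡⟨ lookup-bcCusp-↑ˡ (fromℕ n) ⟩
      lookup J (fromℕ n)                      ≡⟨ not-involutive (lookup J (fromℕ n)) ⟨
      not (not (lookup J (fromℕ n)))          ≡⟨ cong not lookup-J₀-fromℕ ⟨
      not (lookup (J₀ J) (fromℕ n))           ∎
    lookup-bcCusp-prev-↑ʳ (suc i) = begin
      lookup (bcCusp f J) (prev (f ↑ʳ suc i)) ≡⟨ cong (lookup (bcCusp f J)) (prev-↑ʳ-suc i) ⟩
      lookup (bcCusp f J) (f ↑ʳ inject₁ i)    ≡⟨ lookup-bcCusp-↑ʳ (inject₁ i) ⟩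
      not (lookup J (inject₁ i))              ≡⟨ cong not (lookup-J₀-inject₁ i) ⟨
      not (lookup (J₀ J) (inject₁ i))         ∎

-- Everything the factor labelled J needs at index i: i ∈ J, i − 1 ∈ Jp (Jp = J for principal
-- series, J₀ for cuspidal types) and c_i; Adm, sLab and tLab are AdmAt, sAt and tAt of localAt.
data Local : Set where
  local : (member predMember : Bool) (digitᵢ : ℕ) → Local

localAt : ℕ → ∀ {d} → ℕ → Subset d → Subset d → Fin d → Local
localAt p c J Jp i = local (lookup J i) (lookup Jp (prev i)) (digit p c (toℕ i))

local-cong : ∀ {x x' y y' d d'} → x ≡ x' → y ≡ y' → d ≡ d' → local x y d ≡ local x' y' d'
local-cong refl refl refl = refl

AdmAt : ℕ → Local → Set
AdmAt p (local x y d) = (x ≡ true → y ≡ false → d ≢ p ∸ 1) × (x ≡ false → y ≡ true → d ≢ 0)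

sAt : ℕ → Local → ℕ
sAt p (local x y d) = if x then p ∸ 1 ∸ d ∸ δ (not y) else d ∸ δ y

tAt : Local → ℕ
tAt (local x y d) = if x then d + δ (not y) else 0

AdmAt-complement : ∀ {s x y d e} → d + e ≡ s →
                   AdmAt (suc s) (local x y d) → AdmAt (suc s) (local (not x) (not y) e)
AdmAt-complement {s} {false} {true}  {d} {e} d+e≡s (_ , d≢0) =
  (λ _ _ e≡s → d≢0 refl refl (+-cancelʳ-≡ s d 0 (trans (cong (d +_) (sym e≡s)) d+e≡s))) , λ ()
AdmAt-complement {s} {true}  {false} {d} {e} d+e≡s (d≢s , _) =
  (λ ()) , λ _ _ e≡0 → d≢s refl refl (trans (sym (+-identityʳ d)) (trans (cong (d +_) (sym e≡0)) d+e≡s))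
AdmAt-complement {x = false} {false} _ _ = (λ _ ()) , λ ()
AdmAt-complement {x = true}  {true}  _ _ = (λ ()) , λ _ ()

sAt-complement : ∀ {s} x y d e → d + e ≡ s → sAt (suc s) (local (not x) (not y) e) ≡ sAt (suc s) (local x y d)
sAt-complement true  y d e refl = cong (_∸ δ (not y)) (sym (m+n∸m≡n d e))
sAt-complement false y d e refl = cong₂ _∸_ (m+n∸n≡m d e) (cong δ (not-involutive y))

tAt-complement : ∀ {s} x y d e → d + e ≡ s →
                 tAt (local (not x) (not y) e) + d + suc s * δ x ≡ tAt (local x y d) + s + δ y
tAt-complement true  true  d e refl = identity d e
  where identity : ∀ d e → 0 + d + suc (d + e) * 1 ≡ d + 0 + (d + e) + 1
        identity = solve-∀
tAt-complement true  false d e refl = identity d e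
  where identity : ∀ d e → 0 + d + suc (d + e) * 1 ≡ d + 1 + (d + e) + 0
        identity = solve-∀
tAt-complement false true  d e refl = identity d e
  where identity : ∀ d e → e + 1 + d + suc (d + e) * 0 ≡ 0 + (d + e) + 1
        identity = solve-∀
tAt-complement false false d e refl = identity d e
  where identity : ∀ d e → e + 0 + d + suc (d + e) * 0 ≡ 0 + (d + e) + 0
        identity = solve-∀

tAt-pred-not : ∀ x y d → tAt (local x (not y) d) + δ (not y) ≡ tAt (local x y d) + (δ (x ∧ y) + δ (not x ∧ not y))
tAt-pred-not true  true  d = identity d
  where identity : ∀ d → d + 1 + 0 ≡ d + 0 + (1 + 0)
        identity = solve-∀
tAt-pred-not true  false d = identity d
  where identity : ∀ d → d + 0 + 1 ≡ d + 1 + (0 + 0)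
        identity = solve-∀
tAt-pred-not false true  d = refl
tAt-pred-not false false d = refl

-- Exponents

ps-exponent-bc : ∀ q a a' → 2 ≤ q →
  ((q + 1) * a + (q * q ∸ 2) * ((q + 1) * a')) % suc (q * q ∸ 2)
    ≡ (a + (q ∸ 2) * a') % suc (q ∸ 2) + q * ((a + (q ∸ 2) * a') % suc (q ∸ 2))
ps-exponent-bc q a a' 2≤q with m≤n⇒∃[o]m+o≡n 2≤q
... | m , refl = begin
  ((q + 1) * a + (m + suc m * q) * ((q + 1) * a')) % suc (m + suc m * q)
    ≡⟨ cong (_% suc (m + suc m * q)) (regroup m a a') ⟩
  (x * (q + 1)) % suc (m + suc m * q)
    ≡⟨ %-congʳ {o = x * (q + 1)} (modulus m) ⟩
  (x * (q + 1)) % (suc m * (q + 1))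
    ≡⟨ m%n*o≡m*o%[n*o] x (suc m) (q + 1) ⟨
  x % suc m * (q + 1)
    ≡⟨ cong (_* (q + 1)) ([m+kn]%n≡m%n (a + m * a') (a' * q) (suc m)) ⟩
  (a + m * a') % suc m * (q + 1)
    ≡⟨ spread ((a + m * a') % suc m) q ⟩
  (a + m * a') % suc m + q * ((a + m * a') % suc m) ∎
  where
  open ≡-Reasoning
  x = a + m * a' + a' * q * suc m
  regroup : ∀ m a a' → (suc (suc m) + 1) * a + (m + suc m * suc (suc m)) * ((suc (suc m) + 1) * a')
                       ≡ (a + m * a' + a' * suc (suc m) * suc m) * (suc (suc m) + 1)
  regroup = solve-∀
  modulus : ∀ m → suc (m + suc m * suc (suc m)) ≡ suc m * (suc (suc m) + 1)
  modulus = solve-∀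
  spread : ∀ x q → x * (q + 1) ≡ x + q * x
  spread = solve-∀

cusp-exponent-bc : ∀ q b c e → 2 ≤ q → suc (c + e) ≡ q →
  ((q + 1) * b + 1 + c + (q * q ∸ 2) * (q * ((q + 1) * b + 1 + c))) % suc (q * q ∸ 2) ≡ c + q * e
cusp-exponent-bc q b c e 2≤q 1+c+e≡q with m≤n⇒∃[o]m+o≡n 2≤q
... | m , refl = begin
  (ψ + (m + suc m * q) * (q * ψ)) % N  ≡⟨ cong (_% N) (+-cancelʳ-≡ (q * c) (ψ + (m + suc m * q) * (q * ψ)) (c + q * e + K * N) expand) ⟩
  (c + q * e + K * N) % N              ≡⟨ [m+kn]%n≡m%n (c + q * e) K N ⟩
  (c + q * e) % N                      ≡⟨ m<n⇒m%n≡m (s≤s bound) ⟩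
  c + q * e                            ∎
  where
  open ≡-Reasoning
  ψ = (q + 1) * b + 1 + c
  N = suc (m + suc m * q)
  K = (m * m + 5 * m + 5) * b + suc m + c * q
  c+e≡1+m : c + e ≡ suc m
  c+e≡1+m = suc-injective 1+c+e≡q
  identity : ∀ m b c → let q = suc (suc m) in
             (q + 1) * b + 1 + c + (m + suc m * q) * (q * ((q + 1) * b + 1 + c)) + q * c
             ≡ c + q * suc m + ((m * m + 5 * m + 5) * b + suc m + c * q) * suc (m + suc m * q)
  identity = solve-∀
  regroup : ∀ c e q z → c + q * (c + e) + z ≡ c + q * e + z + q * c
  regroup = solve-∀
  expand : ψ + (m + suc m * q) * (q * ψ) + q * c ≡ c + q * e + K * N + q * c
  expand = begin
    ψ + (m + suc m * q) * (q * ψ) + q * c ≡⟨ identity m b c ⟩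
    c + q * suc m + K * N                 ≡⟨ cong (λ k → c + q * k + K * N) c+e≡1+m ⟨
    c + q * (c + e) + K * N               ≡⟨ regroup c e q (K * N) ⟩
    c + q * e + K * N + q * c             ∎
  bound : c + q * e ≤ m + suc m * q
  bound = ≤-trans (+-monoˡ-≤ (q * e) (m≤n*m c q)) (≤-trans (≤-reflexive qc+qe≡) (m≤n+m (suc m * q) m))
    where
    qc+qe≡ : q * c + q * e ≡ suc m * q
    qc+qe≡ = begin
      q * c + q * e  ≡⟨ *-distribˡ-+ q c e ⟨
      q * (c + e)    ≡⟨ cong (q *_) c+e≡1+m ⟩
      q * suc m      ≡⟨ *-comm q (suc m) ⟩
      suc m * q      ∎

cusp-det-identity : ∀ q L H T c b ε (Y : Bool) → 2 ≤ q →
  H + c + δ Y * q + 1 ≡ L + q + δ (not Y) → L + δ (not Y) ≡ T + ε →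
  L + q * H + q * ((q + 1) * b + 1 + c) ≡ T + q * T + (q + 1) * (b + ε) + (b + δ (not Y)) * suc (q * q ∸ 2)
cusp-det-identity q L H T c b ε Y 2≤q high low with m≤n⇒∃[o]m+o≡n 2≤q | Y
... | m , refl | true = +-cancelʳ-≡ (q * q) _ _ (begin
  L + q * H + q * ((q + 1) * b + 1 + c) + q * q  ≡⟨ carryOut L H c b q ⟩
  L + q * (H + c + 1 * q + 1) + q * ((q + 1) * b) ≡⟨ cong (λ z → L + q * z + q * ((q + 1) * b)) high ⟩
  L + q * (L + q + 0) + q * ((q + 1) * b)        ≡⟨ collect L q (q * ((q + 1) * b)) ⟩
  (q + 1) * (L + 0) + q * ((q + 1) * b) + q * q  ≡⟨ cong (λ z → (q + 1) * z + q * ((q + 1) * b) + q * q) low ⟩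
  (q + 1) * (T + ε) + q * ((q + 1) * b) + q * q  ≡⟨ reduce m T ε b ⟩
  T + q * T + (q + 1) * (b + ε) + (b + 0) * suc (q * q ∸ 2) + q * q ∎)
  where
  open ≡-Reasoning
  carryOut : ∀ L H c b q → L + q * H + q * ((q + 1) * b + 1 + c) + q * q ≡ L + q * (H + c + 1 * q + 1) + q * ((q + 1) * b)
  carryOut = solve-∀
  collect : ∀ L q X → L + q * (L + q + 0) + X ≡ (q + 1) * (L + 0) + X + q * q
  collect = solve-∀
  reduce : ∀ m T ε b → let q = suc (suc m) in
           (q + 1) * (T + ε) + q * ((q + 1) * b) + q * q
           ≡ T + q * T + (q + 1) * (b + ε) + (b + 0) * suc (m + suc m * q) + q * q
  reduce = solve-∀
... | m , refl | false = begin
  L + q * H + q * ((q + 1) * b + 1 + c)          ≡⟨ carryIn L H c b q ⟩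
  L + q * (H + c + 0 * q + 1) + q * ((q + 1) * b) ≡⟨ cong (λ z → L + q * z + q * ((q + 1) * b)) high ⟩
  L + q * (L + q + 1) + q * ((q + 1) * b)        ≡⟨ collect m L (q * ((q + 1) * b)) ⟩
  (q + 1) * (L + 1) + q * ((q + 1) * b) + N      ≡⟨ cong (λ z → (q + 1) * z + q * ((q + 1) * b) + N) low ⟩
  (q + 1) * (T + ε) + q * ((q + 1) * b) + N      ≡⟨ reduce m T ε b ⟩
  T + q * T + (q + 1) * (b + ε) + (b + 1) * N    ∎
  where
  open ≡-Reasoning
  N = suc (q * q ∸ 2)
  carryIn : ∀ L H c b q → L + q * H + q * ((q + 1) * b + 1 + c) ≡ L + q * (H + c + 0 * q + 1) + q * ((q + 1) * b)
  carryIn = solve-∀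
  collect : ∀ m L X → let q = suc (suc m) in
            L + q * (L + q + 1) + X ≡ (q + 1) * (L + 1) + X + suc (m + suc m * q)
  collect = solve-∀
  reduce : ∀ m T ε b → let q = suc (suc m) in
           (q + 1) * (T + ε) + q * ((q + 1) * b) + suc (m + suc m * q)
           ≡ T + q * T + (q + 1) * (b + ε) + (b + 1) * suc (m + suc m * q)
  reduce = solve-∀

2≤p^suc : ∀ r n → 2 ≤ suc (suc r) ^ suc n
2≤p^suc r n = ≤-trans (s≤s (s≤s z≤n)) (m≤m*n (suc (suc r)) (suc (suc r) ^ n) {{m^n≢0 (suc (suc r)) n}})

1+[q∸2]≤q : ∀ {q} → 2 ≤ q → suc (q ∸ 2) ≤ q
1+[q∸2]≤q (s≤s (s≤s z≤n)) = n≤1+n _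

-- Base change of the labelled factors

module PrincipalSeries (r n a a' : ℕ) (J : Subset (suc n)) where

  private
    p f q : ℕ
    p = suc (suc r)
    f = suc n
    q = p ^ f
    open BaseDigits (suc r)

  c c' : ℕ
  c  = psC p f a a'
  c' = psC p (f + f) ((q + 1) * a) ((q + 1) * a')

  c'≡c+qc : c' ≡ c + q * c
  c'≡c+qc = trans (cong (λ Q → ((q + 1) * a + (Q ∸ 2) * ((q + 1) * a')) % suc (Q ∸ 2)) (^-distribˡ-+-* p f f))
                  (ps-exponent-bc q a a' (2≤p^suc r n))

  c<q : c < q
  c<q = ≤-trans (m%n<n (a + (q ∸ 2) * a') (suc (q ∸ 2))) (1+[q∸2]≤q (2≤p^suc r n))

  digit-c' : ∀ j → digit p c' (toℕ j) ≡ digit p c (toℕ (modF f j))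
  digit-c' = ↑-elim {f} {f} (λ j → digit p c' (toℕ j) ≡ digit p c (toℕ (modF f j))) low high
    where
    open ≡-Reasoning
    low : ∀ i → digit p c' (toℕ (i ↑ˡ f)) ≡ digit p c (toℕ (modF f (i ↑ˡ f)))
    low i = begin
      digit p c' (toℕ (i ↑ˡ f))          ≡⟨ cong₂ (digit p) c'≡c+qc (toℕ-↑ˡ i f) ⟩
      digit p (c + q * c) (toℕ i)        ≡⟨ digit-+-^-low f c c (toℕ<n i) ⟩
      digit p c (toℕ i)                  ≡⟨ cong (λ k → digit p c (toℕ k)) (modF-↑ˡ f i) ⟨
      digit p c (toℕ (modF f (i ↑ˡ f)))  ∎
    high : ∀ i → digit p c' (toℕ (f ↑ʳ i)) ≡ digit p c (toℕ (modF f (f ↑ʳ i)))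
    high i = begin
      digit p c' (toℕ (f ↑ʳ i))          ≡⟨ cong₂ (digit p) c'≡c+qc (toℕ-↑ʳ f i) ⟩
      digit p (c + q * c) (f + toℕ i)    ≡⟨ digit-+-^-high f c (toℕ i) c<q ⟩
      digit p c (toℕ i)                  ≡⟨ cong (λ k → digit p c (toℕ k)) (modF-↑ʳ f i) ⟨
      digit p c (toℕ (modF f (f ↑ʳ i)))  ∎

  local-bcPS : ∀ j → localAt p c' (bcPS f J) (bcPS f J) j ≡ localAt p c J J (modF f j)
  local-bcPS j = local-cong (lookup-bcPS n J j) (lookup-bcPS-prev n J j) (digit-c' j)

  base-change : psP p f a a' J →
    psP p (f + f) ((q + 1) * a) ((q + 1) * a') (bcPS f J)
    × WtIso p (f + f) (bcW p f (psFactor p f a a' J)) (psFactor p (f + f) ((q + 1) * a) ((q + 1) * a') (bcPS f J))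
  base-change adm =
      (λ j → subst (AdmAt p) (sym (local-bcPS j)) (adm (modF f j)))
    , (λ j → cong (sAt p) (sym (local-bcPS j)))
    , cong (λ v → red p (f + f) (Vec.sum v + (q + 1) * a'))
           (tabulate-cong (λ j → cong (λ l → tAt l * p ^ toℕ j) (sym (local-bcPS j))))

module Cuspidal (r n b c : ℕ) (J : Subset (suc n)) (c<q : c < suc (suc r) ^ suc n) where

  private
    p f q : ℕ
    p = suc (suc r)
    f = suc n
    q = p ^ f
    open BaseDigits (suc r)
    open ≡-Reasoning

  e : ℕ
  e = proj₁ (m≤n⇒∃[o]m+o≡n c<q)

  1+c+e≡q : suc (c + e) ≡ q
  1+c+e≡q = proj₂ (m≤n⇒∃[o]m+o≡n c<q)

  ψ c' : ℕ
  ψ  = cuspψ p f b c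
  c' = psC p (f + f) ψ (q * ψ)

  J' : Subset (f + f)
  J' = bcCusp f J

  w : Weight f
  w = cuspFactor p f b c J

  w' : Weight (f + f)
  w' = psFactor p (f + f) ψ (q * ψ) J'

  c'≡c+qe : c' ≡ c + q * e
  c'≡c+qe = trans (cong (λ Q → (ψ + (Q ∸ 2) * (q * ψ)) % suc (Q ∸ 2)) (^-distribˡ-+-* p f f))
                  (cusp-exponent-bc q b c e (2≤p^suc r n) 1+c+e≡q)

  digits-complementary : ∀ (i : Fin f) → digit p c (toℕ i) + digit p e (toℕ i) ≡ suc r
  digits-complementary i = digit-complement f 1+c+e≡q (toℕ<n i)

  lowerLocal upperLocal : Fin f → Local
  lowerLocal = localAt p c J (J₀ J)
  upperLocal i = local (not (lookup J i)) (not (lookup (J₀ J) (prev i))) (digit p e (toℕ i))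

  local-↑ˡ : ∀ i → localAt p c' J' J' (i ↑ˡ f) ≡ lowerLocal i
  local-↑ˡ i = local-cong (lookup-bcCusp-↑ˡ n J i) (lookup-bcCusp-prev-↑ˡ n J i)
    (trans (cong₂ (digit p) c'≡c+qe (toℕ-↑ˡ i f)) (digit-+-^-low f c e (toℕ<n i)))

  local-↑ʳ : ∀ i → localAt p c' J' J' (f ↑ʳ i) ≡ upperLocal i
  local-↑ʳ i = local-cong (lookup-bcCusp-↑ʳ n J i) (lookup-bcCusp-prev-↑ʳ n J i)
    (trans (cong₂ (digit p) c'≡c+qe (toℕ-↑ʳ f i)) (digit-+-^-high f e (toℕ i) c<q))

  admissible : cuspP p f c J → psP p (f + f) ψ (q * ψ) J'
  admissible adm = ↑-elim {f} {f} (λ j → AdmAt p (localAt p c' J' J' j))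
    (λ i → subst (AdmAt p) (sym (local-↑ˡ i)) (adm i))
    (λ i → subst (AdmAt p) (sym (local-↑ʳ i)) (AdmAt-complement (digits-complementary i) (adm i)))

  same-s : ∀ j → Weight.s (bcW p f w) j ≡ Weight.s w' j
  same-s = ↑-elim {f} {f} (λ j → Weight.s (bcW p f w) j ≡ Weight.s w' j) low high
    where
    low : ∀ i → sAt p (lowerLocal (modF f (i ↑ˡ f))) ≡ sAt p (localAt p c' J' J' (i ↑ˡ f))
    low i = trans (cong (sAt p ∘ lowerLocal) (modF-↑ˡ f i)) (cong (sAt p) (sym (local-↑ˡ i)))
    high : ∀ i → sAt p (lowerLocal (modF f (f ↑ʳ i))) ≡ sAt p (localAt p c' J' J' (f ↑ʳ i))
    high i = begin
      sAt p (lowerLocal (modF f (f ↑ʳ i)))  ≡⟨ cong (sAt p ∘ lowerLocal) (modF-↑ʳ f i) ⟩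
      sAt p (lowerLocal i)                  ≡⟨ sAt-complement (lookup J i) (lookup (J₀ J) (prev i)) _ _ (digits-complementary i) ⟨
      sAt p (upperLocal i)                  ≡⟨ cong (sAt p) (local-↑ʳ i) ⟨
      sAt p (localAt p c' J' J' (f ↑ʳ i))   ∎

  Y : Bool
  Y = lookup J (fromℕ n)

  ε L H T : ℕ
  ε = δ (memℕ J 0 ∧ memℕ J (f ∸ 1)) + δ (not (memℕ J 0) ∧ not (memℕ J (f ∸ 1)))
  L = radix p (tAt ∘ lowerLocal)
  H = radix p (tAt ∘ upperLocal)
  T = radix p (tLab p f c J)

  detExp-bcW : detExp p (bcW p f w) ≡ T + q * T + (q + 1) * (b + ε)
  detExp-bcW = begin
    detExp p (bcW p f w)
      ≡⟨ detExp-radix p (bcW p f w) ⟩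
    radix p (tLab p f c J ∘ modF f) + (q + 1) * Weight.tw w
      ≡⟨ cong₂ _+_ (radix-↑ p f (tLab p f c J ∘ modF f)) (cong ((q + 1) *_) (+-assoc b _ _)) ⟩
    radix p (λ i → tLab p f c J (modF f (i ↑ˡ f))) + q * radix p (λ i → tLab p f c J (modF f (f ↑ʳ i)))
      + (q + 1) * (b + ε)
      ≡⟨ cong (λ x → x + (q + 1) * (b + ε))
              (cong₂ (λ x y → x + q * y) (radix-cong p (cong (tLab p f c J) ∘ modF-↑ˡ f))
                                        (radix-cong p (cong (tLab p f c J) ∘ modF-↑ʳ f))) ⟩
    T + q * T + (q + 1) * (b + ε) ∎

  detExp-w' : detExp p w' ≡ L + q * H + q * ψ
  detExp-w' = begin
    detExp p w'
      ≡⟨ detExp-radix p w' ⟩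
    radix p (Weight.t w') + q * ψ
      ≡⟨ cong (_+ q * ψ) (radix-↑ p f (Weight.t w')) ⟩
    radix p (λ i → Weight.t w' (i ↑ˡ f)) + q * radix p (λ i → Weight.t w' (f ↑ʳ i)) + q * ψ
      ≡⟨ cong (_+ q * ψ) (cong₂ (λ x y → x + q * y) (radix-cong p (cong tAt ∘ local-↑ˡ))
                                                   (radix-cong p (cong tAt ∘ local-↑ʳ))) ⟩
    L + q * H + q * ψ ∎

  -- Sum tAt-complement against p^i: the carries p · δ(i ∈ J) land in position i + 1, where
  -- radix-rotate matches them with δ(i ∈ J₀); only the wrap-around at f − 1 survives.
  upper-lower : H + c + δ Y * q + 1 ≡ L + q + δ (not Y)
  upper-lower = combine {H + c} {p * X} {L} {radix p {f} (λ _ → suc r)} {Y'} {δ (not Y)} {δ Y * q}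
                        digitwise rotated (radix-all-max f)
    where
    X Y' : ℕ
    X  = radix p (δ ∘ lookup J)
    Y' = radix p (λ i → δ (lookup (J₀ J) (prev i)))
    digitwise : H + c + p * X ≡ L + radix p {f} (λ _ → suc r) + Y'
    digitwise = begin
      H + c + p * X
        ≡⟨ cong₂ (λ x y → H + x + y) (radix-digits f {c} c<q) (radix-*ˡ p {f} p (δ ∘ lookup J)) ⟨
      H + radix p {f} (λ i → digit p c (toℕ i)) + radix p (λ i → p * δ (lookup J i))
        ≡⟨ cong (_+ radix p (λ i → p * δ (lookup J i))) (radix-+ p {f} (tAt ∘ upperLocal) (λ i → digit p c (toℕ i))) ⟨
      radix p (λ i → tAt (upperLocal i) + digit p c (toℕ i)) + radix p (λ i → p * δ (lookup J i))
        ≡⟨ radix-+ p {f} (λ i → tAt (upperLocal i) + digit p c (toℕ i)) (λ i → p * δ (lookup J i)) ⟨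
      radix p (λ i → tAt (upperLocal i) + digit p c (toℕ i) + p * δ (lookup J i))
        ≡⟨ radix-cong p (λ i → tAt-complement (lookup J i) (lookup (J₀ J) (prev i))
                                              (digit p c (toℕ i)) (digit p e (toℕ i)) (digits-complementary i)) ⟩
      radix p (λ i → tAt (lowerLocal i) + suc r + δ (lookup (J₀ J) (prev i)))
        ≡⟨ radix-+ p {f} (λ i → tAt (lowerLocal i) + suc r) (λ i → δ (lookup (J₀ J) (prev i))) ⟩
      radix p (λ i → tAt (lowerLocal i) + suc r) + Y'
        ≡⟨ cong (_+ Y') (radix-+ p {f} (tAt ∘ lowerLocal) (λ _ → suc r)) ⟩
      L + radix p {f} (λ _ → suc r) + Y' ∎
    rotated : p * X + δ (not Y) ≡ Y' + δ Y * q
    rotated = trans (cong (λ y → p * X + δ y) (sym (lookup-J₀-fromℕ n J)))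
      (radix-rotate p (δ ∘ lookup J) (λ i → δ (lookup (J₀ J) (prev i))) (cong δ ∘ lookup-J₀-inject₁ n J))
    combine : ∀ {A P L Z Y' y₀ D q} → A + P ≡ L + Z + Y' → P + y₀ ≡ Y' + D → Z + 1 ≡ q → A + D + 1 ≡ L + q + y₀
    combine {A} {P} {L} {Z} {Y'} {y₀} {D} eq₁ eq₂ refl = +-cancelʳ-≡ Y' _ _ (begin
      A + D + 1 + Y'      ≡⟨ shuffle₁ A D Y' ⟩
      A + 1 + (Y' + D)    ≡⟨ cong (A + 1 +_) eq₂ ⟨
      A + 1 + (P + y₀)    ≡⟨ shuffle₂ A P y₀ ⟩
      A + P + 1 + y₀      ≡⟨ cong (λ x → x + 1 + y₀) eq₁ ⟩
      L + Z + Y' + 1 + y₀ ≡⟨ shuffle₃ L Z Y' y₀ ⟩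
      L + (Z + 1) + y₀ + Y' ∎)
      where
      shuffle₁ : ∀ A D Y' → A + D + 1 + Y' ≡ A + 1 + (Y' + D)
      shuffle₁ = solve-∀
      shuffle₂ : ∀ A P y₀ → A + 1 + (P + y₀) ≡ A + P + 1 + y₀
      shuffle₂ = solve-∀
      shuffle₃ : ∀ L Z Y' y₀ → L + Z + Y' + 1 + y₀ ≡ L + (Z + 1) + y₀ + Y'
      shuffle₃ = solve-∀

  lower-base : L + δ (not Y) ≡ T + ε
  lower-base = begin
    L + δ (not Y)
      ≡⟨ cong (_+ δ (not Y)) (radix-suc p (tAt ∘ lowerLocal)) ⟩
    tAt (lowerLocal zero) + p * radix p (tAt ∘ lowerLocal ∘ suc) + δ (not Y)
      ≡⟨ cong₂ (λ x y → tAt x + p * y + δ (not Y))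
               (cong (λ y → local X₀ y c₀) (lookup-J₀-fromℕ n J))
               (radix-cong p {n} (λ k → cong (λ y → tAt (local (lookup J (suc k)) y (digit p c (suc (toℕ k)))))
                                             (lookup-J₀-inject₁ n J k))) ⟩
    tAt (local X₀ (not Y) c₀) + p * R + δ (not Y)
      ≡⟨ m+n+o≡m+o+n (tAt (local X₀ (not Y) c₀)) (p * R) (δ (not Y)) ⟩
    tAt (local X₀ (not Y) c₀) + δ (not Y) + p * R
      ≡⟨ cong (_+ p * R) (tAt-pred-not X₀ Y c₀) ⟩
    tAt (local X₀ Y c₀) + (δ (X₀ ∧ Y) + δ (not X₀ ∧ not Y)) + p * R
      ≡⟨ cong (λ x → tAt (local X₀ Y c₀) + x + p * R) twist ⟩
    tAt (local X₀ Y c₀) + ε + p * R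
      ≡⟨ m+n+o≡m+o+n (tAt (local X₀ Y c₀)) ε (p * R) ⟩
    tAt (local X₀ Y c₀) + p * R + ε
      ≡⟨ cong (_+ ε) (radix-suc p (tLab p f c J)) ⟨
    T + ε ∎
    where
    X₀ : Bool
    X₀ = lookup J zero
    c₀ R : ℕ
    c₀ = digit p c 0
    R  = radix p (tLab p f c J ∘ suc)
    twist : δ (X₀ ∧ Y) + δ (not X₀ ∧ not Y) ≡ ε
    twist = cong₂ (λ x y → δ (x ∧ y) + δ (not x ∧ not y))
                  (lookup≡memℕ J zero) (trans (lookup≡memℕ J (fromℕ n)) (cong (memℕ J) (toℕ-fromℕ n)))

  same-detExp : red p (f + f) (detExp p (bcW p f w)) ≡ red p (f + f) (detExp p w')
  same-detExp = begin
    detExp p (bcW p f w) % N                   ≡⟨ [m+kn]%n≡m%n (detExp p (bcW p f w)) (b + δ (not Y)) N ⟨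
    (detExp p (bcW p f w) + (b + δ (not Y)) * N) % N ≡⟨ cong (_% N) detExp-w'≡ ⟨
    detExp p w' % N ∎
    where
    N : ℕ
    N = suc (p ^ (f + f) ∸ 2)
    detExp-w'≡ : detExp p w' ≡ detExp p (bcW p f w) + (b + δ (not Y)) * N
    detExp-w'≡ = begin
      detExp p w'
        ≡⟨ detExp-w' ⟩
      L + q * H + q * ψ
        ≡⟨ cusp-det-identity q L H T c b ε Y (2≤p^suc r n) upper-lower lower-base ⟩
      T + q * T + (q + 1) * (b + ε) + (b + δ (not Y)) * suc (q * q ∸ 2)
        ≡⟨ cong₂ (λ x Q → x + (b + δ (not Y)) * suc (Q ∸ 2)) detExp-bcW (^-distribˡ-+-* p f f) ⟨
      detExp p (bcW p f w) + (b + δ (not Y)) * N ∎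

  base-change : cuspP p f c J → psP p (f + f) ψ (q * ψ) J' × WtIso p (f + f) (bcW p f w) w'
  base-change adm = admissible adm , same-s , same-detExp

-- The hypotheses η ≠ η' and b ≤ q − 2 only ensure that the types are well defined.
lemma3p4p1 : (p f : ℕ) → Prime p → 1 ≤ f →
    -- principal series types σ(η ⊗ η'), η = [·]^a, η' = [·]^{a'}, η ≠ η'
    ((a a' : ℕ) (J : Subset f) → red p f a ≢ red p f a' → psP p f a a' J →
      psP p (f + f) ((p ^ f + 1) * a) ((p ^ f + 1) * a') (bcPS f J)
      × WtIso p (f + f) (bcW p f (psFactor p f a a' J))
          (psFactor p (f + f) ((p ^ f + 1) * a) ((p ^ f + 1) * a') (bcPS f J)))
    ×
    -- cuspidal types Θ(ψ), ψ = [·]^{(q+1)b+1+c}; BC(Θ(ψ)) = σ(ψ ⊗ ψ^q)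
    ((b c : ℕ) (J : Subset f) → b + 2 ≤ p ^ f → c < p ^ f → cuspP p f c J →
      psP p (f + f) (cuspψ p f b c) (p ^ f * cuspψ p f b c) (bcCusp f J)
      × WtIso p (f + f) (bcW p f (cuspFactor p f b c J))
          (psFactor p (f + f) (cuspψ p f b c) (p ^ f * cuspψ p f b c) (bcCusp f J)))
lemma3p4p1 p f p-prime 1≤f with nonTrivial⇒n>1 p {{prime⇒nonTrivial p-prime}}
lemma3p4p1 (suc (suc r)) (suc n) _ (s≤s z≤n) | s≤s (s≤s z≤n) =
    (λ a a' J _ → PrincipalSeries.base-change r n a a' J)
  , (λ b c J _ c<q → Cuspidal.base-change r n b c J c<q)
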